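{- Let $x$ be a sequence of pairwise distinct integers of length $m$, let $i\in\{1,\ldots,m-1\}$ with $x[i]<x[i+1]$, and $y=\tau(x,i)$. Then $\overrightarrow{PD}_y[i]\in\{\,i-pos \mid pos\in \mathrm{rb}(\mathrm{left}(C_i(x)))\,\}\cup\{\overrightarrow{PD}_x[i]\}$.
   Context: All sequences consist of pairwise distinct integers. $\tau(x,i)$ exchanges $x[i]$ and $x[i+1]$. The Cartesian tree $C(x)$ of $x[1\ldots m]$: empty if $x$ is empty; otherwise the root is the node labeled by the position $g$ of the minimum of $x$, with left subtree $C(x[1\ldots g-1])$ and right subtree the Cartesian tree of $x[g+1\ldots m]$ (nodes labeled by their positions in $x$). $C_h(x)$ is the subtree of $C(x)$ rooted at node $h$; $\mathrm{left}(T)$ is the left subtree of a binary tree $T$, and $\mathrm{rb}(T)$ is the set of nodes on the right branch of $T$ (the root and its successive right children; empty if $T$ is empty). $\overrightarrow{PD}_x[h]=h-\max\{j<h: x[j]<x[h]\}$ if such $j$ exists, $0$ otherwise. -}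

module Defs where

open import Data.Nat using (ℕ; zero; suc; _+_; _∸_)
open import Data.Nat as ℕ using ()
open import Data.Integer using (ℤ; 0ℤ) renaming (_<?_ to _<ℤ?_)
open import Data.List using (List; []; _∷_; length)
open import Data.Maybe using (Maybe; just; nothing)
open import Relation.Nullary using (yes; no)

-- Sequences are lists of integers; positions are 1-based.

-- 0-based lookup (junk value 0 outside the range; never used in range statements)
get0 : List ℤ → ℕ → ℤ
get0 []       _       = 0ℤ
get0 (a ∷ xs) zero    = a
get0 (a ∷ xs) (suc k) = get0 xs k

at : List ℤ → ℕ → ℤ
at x i = get0 x (i ∸ 1)

swap0 : List ℤ → ℕ → List ℤ
swap0 (a ∷ b ∷ xs) zero    = b ∷ a ∷ xs
swap0 (a ∷ xs)     (suc k) = a ∷ swap0 xs k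
swap0 xs           _       = xs

τ : List ℤ → ℕ → List ℤ
τ x i = swap0 x (i ∸ 1)

data Tree : Set where
  leaf : Tree
  node : Tree → ℕ → Tree → Tree

minPos : List ℤ → ℕ → ℕ → ℕ
minPos x lo zero    = lo
minPos x lo (suc n) with at x lo <ℤ? at x (minPos x (suc lo) n)
... | yes _ = lo
... | no  _ = minPos x (suc lo) n

-- Cartesian tree of the segment x[lo .. lo+len-1], nodes labeled by their
-- positions in x; the first argument is fuel (≥ len suffices).
cartF : ℕ → List ℤ → ℕ → ℕ → Tree
cartF zero     x lo len       = leaf
cartF (suc f)  x lo zero      = leaf
cartF (suc f)  x lo (suc n)   =
  let g = minPos x lo n in
  node (cartF f x lo (g ∸ lo)) g (cartF f x (suc g) ((lo + n) ∸ g))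

C : List ℤ → Tree
C x = cartF (length x) x 1 (length x)

-- subtree rooted at node h (leaf if h is not a node); uses that labels are
-- in in-order (search-tree) order
subtreeAt : ℕ → Tree → Tree
subtreeAt h leaf = leaf
subtreeAt h (node l g r) with h ℕ.≟ g
... | yes _ = node l g r
... | no  _ with h ℕ.<? g
...   | yes _ = subtreeAt h l
...   | no  _ = subtreeAt h r

Csub : List ℤ → ℕ → Tree
Csub x h = subtreeAt h (C x)

left : Tree → Tree
left leaf         = leaf
left (node l _ _) = l

rb : Tree → List ℕ
rb leaf         = []
rb (node _ g r) = g ∷ rb r

lastSmaller : List ℤ → ℤ → ℕ → Maybe ℕ
lastSmaller x v zero    = nothing
lastSmaller x v (suc k) with at x (suc k) <ℤ? v
... | yes _ = just (suc k)
... | no  _ = lastSmaller x v k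

PD : List ℤ → ℕ → ℕ
PD x h with lastSmaller x (at x h) (h ∸ 1)
... | just j  = h ∸ j
... | nothing = 0

{-# OPTIONS --safe #-}
-- Write u = x[i] < v = x[i+1]. Before position i the sequence y agrees with x, and y[i] = v,
-- so PD_y[i] is determined by the last position j < i with x[j] < v. If there is no such j,
-- or x[j] < u, then j is also the last position before i with a value below u, and
-- PD_y[i] = PD_x[i]. Otherwise u < x[j] < v and every x[q] with j < q < i exceeds v.
-- The left subtree of C_i(x) is the Cartesian tree of the segment strictly between the
-- previous smaller value of x[i] and i; j lies in that segment and is a suffix minimum
-- of it, and suffix minima of a segment lie on the right branch of its Cartesian tree.
module Submission where

open import Defs
open import Data.Nat using (ℕ; _≤_; _<_; _∸_; suc; zero; _+_; z≤n; s≤s)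
open import Data.Nat as ℕ using ()
import Data.Nat.Properties as ℕₚ
open import Data.Integer using (ℤ) renaming (_<_ to _<ℤ_; _≤_ to _≤ℤ_; _<?_ to _<ℤ?_)
import Data.Integer.Properties as ℤₚ
open import Data.List using (List; length; map; []; _∷_)
open import Data.List.Relation.Unary.Unique.Propositional using (Unique)
open import Data.List.Relation.Unary.All using (All; _∷_)
open import Data.List.Relation.Unary.AllPairs using (_∷_)
open import Data.List.Membership.Propositional using (_∈_)
open import Data.List.Membership.Propositional.Properties using (∈-map⁺)
open import Data.List.Relation.Unary.Any using (here; there)
open import Data.Maybe using (just; nothing; maybe)
import Data.Maybe.Relation.Unary.All as Maybe
open import Data.Product using (_×_; _,_; proj₁; proj₂)
open import Data.Sum using (_⊎_; inj₁; inj₂)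
import Data.Sum as Sum
open import Data.Empty using (⊥-elim)
open import Relation.Binary using (tri<; tri≈; tri>)
open import Relation.Nullary using (yes; no; ¬_)
open import Relation.Binary.PropositionalEquality
  using (_≡_; _≢_; refl; sym; trans; cong; subst; module ≡-Reasoning)

All-get0 : ∀ {P : ℤ → Set} xs k → All P xs → k < length xs → P (get0 xs k)
All-get0 (a ∷ xs) zero    (pa ∷ _)   _         = pa
All-get0 (a ∷ xs) (suc k) (_  ∷ pxs) (s≤s k<n) = All-get0 xs k pxs k<n

get0-injective : ∀ xs {j k} → Unique xs → j < k → k < length xs → get0 xs j ≢ get0 xs k
get0-injective (a ∷ xs) {zero}  {suc k} (a∉xs ∷ _) _ (s≤s k<n) = All-get0 xs k a∉xs k<n
get0-injective (a ∷ xs) {suc j} {suc k} (_ ∷ uxs) (s≤s j<k) (s≤s k<n) =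
  get0-injective xs uxs j<k k<n

at-injective : ∀ x {j k} → Unique x → 1 ≤ j → j < k → k ≤ length x → at x j ≢ at x k
at-injective x {suc j} {suc k} ux _ (s≤s j<k) k≤n = get0-injective x ux j<k k≤n

get0-swap0-< : ∀ xs {j k} → j < k → get0 (swap0 xs k) j ≡ get0 xs j
get0-swap0-< []           _                           = refl
get0-swap0-< (a ∷ [])     {zero}  {suc k} _         = refl
get0-swap0-< (a ∷ [])     {suc j} {suc k} (s≤s j<k) = get0-swap0-< [] j<k
get0-swap0-< (a ∷ b ∷ xs) {zero}  {suc k} _         = refl
get0-swap0-< (a ∷ b ∷ xs) {suc j} {suc k} (s≤s j<k) = get0-swap0-< (b ∷ xs) j<k

get0-swap0-self : ∀ xs k → suc k < length xs → get0 (swap0 xs k) k ≡ get0 xs (suc k)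
get0-swap0-self (a ∷ [])     zero    (s≤s ())
get0-swap0-self (a ∷ b ∷ xs) zero    _         = refl
get0-swap0-self (a ∷ b ∷ xs) (suc k) (s≤s k<n) = get0-swap0-self (b ∷ xs) k k<n

at-τ-< : ∀ x {i q} → 1 ≤ q → q < i → at (τ x i) q ≡ at x q
at-τ-< x {suc i} {suc q} _ (s≤s q<i) = get0-swap0-< x q<i

at-τ : ∀ x {i} → 1 ≤ i → i < length x → at (τ x i) i ≡ at x (suc i)
at-τ x {suc i} _ i<n = get0-swap0-self x i i<n

PD-lastSmaller : ∀ x h → PD x h ≡ maybe (h ∸_) 0 (lastSmaller x (at x h) (h ∸ 1))
PD-lastSmaller x h with lastSmaller x (at x h) (h ∸ 1)
... | just j  = refl
... | nothing = refl

lastSmaller-cong : ∀ {x y} v k → (∀ q → 1 ≤ q → q ≤ k → at y q ≡ at x q) →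
  lastSmaller y v k ≡ lastSmaller x v k
lastSmaller-cong v zero _ = refl
lastSmaller-cong {x} {y} v (suc k) y≗x with at y (suc k) <ℤ? v | at x (suc k) <ℤ? v
... | yes _   | yes _   = refl
... | no _    | no _    = lastSmaller-cong v k (λ q 1≤q q≤k → y≗x q 1≤q (ℕₚ.m≤n⇒m≤1+n q≤k))
... | yes y<v | no x≮v  = ⊥-elim (x≮v (subst (_<ℤ v) (y≗x (suc k) (s≤s z≤n) ℕₚ.≤-refl) y<v))
... | no y≮v  | yes x<v = ⊥-elim (y≮v (subst (_<ℤ v) (sym (y≗x (suc k) (s≤s z≤n) ℕₚ.≤-refl)) x<v))

record IsLastBelow (x : List ℤ) (v : ℤ) (k j : ℕ) : Set where
  field
    1≤j   : 1 ≤ j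
    j≤k   : j ≤ k
    below : at x j <ℤ v
    last  : ∀ q → j < q → q ≤ k → ¬ at x q <ℤ v

lastSmaller-just : ∀ x v k {j} → lastSmaller x v k ≡ just j → IsLastBelow x v k j
lastSmaller-just x v (suc k) eq with at x (suc k) <ℤ? v
lastSmaller-just x v (suc k) refl | yes xk<v = record
  { 1≤j = s≤s z≤n ; j≤k = ℕₚ.≤-refl ; below = xk<v
  ; last = λ q k<q q≤k → ⊥-elim (ℕₚ.<⇒≱ k<q q≤k) }
lastSmaller-just x v (suc k) {j} eq | no xk≮v = record
  { 1≤j = 1≤j ; j≤k = ℕₚ.m≤n⇒m≤1+n j≤k ; below = below ; last = last′ }
  where
  open IsLastBelow (lastSmaller-just x v k eq)
  last′ : ∀ q → j < q → q ≤ suc k → ¬ at x q <ℤ v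
  last′ q j<q q≤1+k with ℕₚ.m≤n⇒m<n∨m≡n q≤1+k
  ... | inj₁ q<1+k = last q j<q (ℕₚ.≤-pred q<1+k)
  ... | inj₂ refl  = xk≮v

lastSmaller-below : ∀ x {u v} k → u <ℤ v → Maybe.All (λ j → at x j <ℤ u) (lastSmaller x v k) →
  lastSmaller x u k ≡ lastSmaller x v k
lastSmaller-below x zero _ _ = refl
lastSmaller-below x {u} {v} (suc k) u<v below with at x (suc k) <ℤ? v | at x (suc k) <ℤ? u
... | yes _   | yes _   = refl
... | yes _   | no xk≮u = ⊥-elim (xk≮u (Maybe.drop-just below))
... | no xk≮v | yes xk<u = ⊥-elim (xk≮v (ℤₚ.<-trans xk<u u<v))
... | no _    | no _    = lastSmaller-below x k u<v below

module SegmentSplit {a n g : ℕ} (bounds : a ≤ g × g ≤ a + n) where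

  left-end : a + (g ∸ a) ≡ g
  left-end = ℕₚ.m+[n∸m]≡n (proj₁ bounds)

  left-length≤ : g ∸ a ≤ n
  left-length≤ = ℕₚ.m≤n+o⇒m∸n≤o g a (proj₂ bounds)

  right-end : suc g + (a + n ∸ g) ≡ a + suc n
  right-end = trans (cong suc (ℕₚ.m+[n∸m]≡n (proj₂ bounds))) (sym (ℕₚ.+-suc a n))

  right-length≤ : a + n ∸ g ≤ n
  right-length≤ = ℕₚ.m≤n+o⇒m∸n≤o (a + n) g (ℕₚ.+-monoˡ-≤ n (proj₁ bounds))

  split<end : g < a + suc n
  split<end = subst (g <_) (sym (ℕₚ.+-suc a n)) (s≤s (proj₂ bounds))

∉-empty-segment : ∀ {a p} → a ≤ p → ¬ p < a + 0
∉-empty-segment {a} a≤p p<a+0 = ℕₚ.<⇒≱ (subst (_ <_) (ℕₚ.+-identityʳ a) p<a+0) a≤p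

subtreeAt-root : ∀ l g r → subtreeAt g (node l g r) ≡ node l g r
subtreeAt-root l g r with g ℕ.≟ g
... | yes _   = refl
... | no g≢g = ⊥-elim (g≢g refl)

subtreeAt-< : ∀ {h g} l r → h < g → subtreeAt h (node l g r) ≡ subtreeAt h l
subtreeAt-< {h} {g} l r h<g with h ℕ.≟ g
... | yes h≡g = ⊥-elim (ℕₚ.<-irrefl h≡g h<g)
... | no _ with h ℕ.<? g
...   | yes _   = refl
...   | no h≮g = ⊥-elim (h≮g h<g)

subtreeAt-> : ∀ {h g} l r → g < h → subtreeAt h (node l g r) ≡ subtreeAt h r
subtreeAt-> {h} {g} l r g<h with h ℕ.≟ g
... | yes h≡g = ⊥-elim (ℕₚ.<-irrefl (sym h≡g) g<h)
... | no _ with h ℕ.<? g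
...   | yes h<g = ⊥-elim (ℕₚ.<-asym h<g g<h)
...   | no _    = refl

module _ (x : List ℤ) where

  minPos-bounds : ∀ a n → a ≤ minPos x a n × minPos x a n ≤ a + n
  minPos-bounds a zero = ℕₚ.≤-refl , ℕₚ.m≤m+n a 0
  minPos-bounds a (suc n) with at x a <ℤ? at x (minPos x (suc a) n)
  ... | yes _ = ℕₚ.≤-refl , ℕₚ.m≤m+n a (suc n)
  ... | no _ with minPos-bounds (suc a) n
  ...   | a<g , g≤end = ℕₚ.<⇒≤ a<g , subst (minPos x (suc a) n ≤_) (sym (ℕₚ.+-suc a n)) g≤end

  minPos-minimal : ∀ a n q → a ≤ q → q ≤ a + n → at x (minPos x a n) ≤ℤ at x q
  minPos-minimal a zero q a≤q q≤a+0 with ℕₚ.≤-antisym a≤q (subst (q ≤_) (ℕₚ.+-identityʳ a) q≤a+0)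
  ... | refl = ℤₚ.≤-refl
  minPos-minimal a (suc n) q a≤q q≤end with at x a <ℤ? at x (minPos x (suc a) n) | ℕₚ.m≤n⇒m<n∨m≡n a≤q
  ... | yes _     | inj₂ refl = ℤₚ.≤-refl
  ... | yes xa<xg | inj₁ a<q  = ℤₚ.<⇒≤ (ℤₚ.<-≤-trans xa<xg
                                  (minPos-minimal (suc a) n q a<q (subst (q ≤_) (ℕₚ.+-suc a n) q≤end)))
  ... | no xa≮xg  | inj₂ refl = ℤₚ.≮⇒≥ xa≮xg
  ... | no _      | inj₁ a<q  = minPos-minimal (suc a) n q a<q (subst (q ≤_) (ℕₚ.+-suc a n) q≤end)

  suffixMin∈rb : ∀ f a n p → n ≤ f → a ≤ p → p < a + n →
    (∀ q → p < q → q < a + n → at x p <ℤ at x q) → p ∈ rb (cartF f x a n)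
  suffixMin∈rb f a zero p _ a≤p p<a+0 _ = ⊥-elim (∉-empty-segment a≤p p<a+0)
  suffixMin∈rb zero a (suc n) p ()
  suffixMin∈rb (suc f) a (suc n) p (s≤s n≤f) a≤p p<end p-min with ℕ.<-cmp p (minPos x a n)
  ... | tri≈ _ p≡g _ = here p≡g
  ... | tri< p<g _ _ = ⊥-elim (ℤₚ.<⇒≱ (p-min _ p<g split<end)
                         (minPos-minimal a n p a≤p (ℕₚ.<⇒≤ (ℕₚ.<-≤-trans p<g (proj₂ (minPos-bounds a n))))))
    where open SegmentSplit (minPos-bounds a n)
  ... | tri> _ _ g<p = there (suffixMin∈rb f _ _ p (ℕₚ.≤-trans right-length≤ n≤f) g<p
                         (subst (p <_) (sym right-end) p<end)
                         (λ q p<q q<end → p-min q p<q (subst (q <_) right-end q<end)))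
    where open SegmentSplit (minPos-bounds a n)

  LeftFenced : ℕ → ℕ → Set
  LeftFenced a n = a ≡ 1 ⊎ (∀ q → a ≤ q → q < a + n → at x (a ∸ 1) ≤ℤ at x q)

  record LeftSubtreeSegment (h : ℕ) (S : Tree) : Set where
    field
      start fuel  : ℕ
      start≤h     : start ≤ h
      length≤fuel : h ∸ start ≤ fuel
      fenced      : start ≡ 1 ⊎ at x (start ∸ 1) ≤ℤ at x h
      left≡cartF  : left S ≡ cartF fuel x start (h ∸ start)

  leftSubtreeSegment : ∀ f a n h → n ≤ f → a ≤ h → h < a + n → LeftFenced a n →
    LeftSubtreeSegment h (subtreeAt h (cartF f x a n))
  leftSubtreeSegment f a zero h _ a≤h h<a+0 _ = ⊥-elim (∉-empty-segment a≤h h<a+0)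
  leftSubtreeSegment zero a (suc n) h ()
  leftSubtreeSegment (suc f) a (suc n) h (s≤s n≤f) a≤h h<end fence with ℕ.<-cmp h (minPos x a n)
  ... | tri≈ _ refl _ = subst (LeftSubtreeSegment h) (sym (subtreeAt-root _ h _)) (record
    { start = a ; fuel = f ; start≤h = a≤h
    ; length≤fuel = ℕₚ.≤-trans left-length≤ n≤f
    ; fenced = Sum.map₂ (λ a-1≤ → a-1≤ h a≤h h<end) fence
    ; left≡cartF = refl })
    where open SegmentSplit (minPos-bounds a n)
  ... | tri< h<g _ _ = subst (LeftSubtreeSegment h) (sym (subtreeAt-< _ _ h<g))
    (leftSubtreeSegment f a _ h (ℕₚ.≤-trans left-length≤ n≤f) a≤h
      (subst (h <_) (sym left-end) h<g)
      (Sum.map₂ (λ a-1≤ q a≤q q<g → a-1≤ q a≤q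
        (ℕₚ.<-trans (subst (q <_) left-end q<g) split<end)) fence))
    where open SegmentSplit (minPos-bounds a n)
  ... | tri> _ _ g<h = subst (LeftSubtreeSegment h) (sym (subtreeAt-> _ _ g<h))
    (leftSubtreeSegment f _ _ h (ℕₚ.≤-trans right-length≤ n≤f) g<h
      (subst (h <_) (sym right-end) h<end)
      (inj₂ λ q g<q q<end → minPos-minimal a n q
        (ℕₚ.≤-trans (proj₁ (minPos-bounds a n)) (ℕₚ.<⇒≤ g<q))
        (ℕₚ.≤-pred (subst (q <_) (trans right-end (ℕₚ.+-suc a n)) q<end))))
    where open SegmentSplit (minPos-bounds a n)

lastSmaller∈rb-left : ∀ x {v i j} → Unique x → 1 ≤ i → i ≤ length x → at x i <ℤ v →
  lastSmaller x v (i ∸ 1) ≡ just j → ¬ at x j <ℤ at x i → j ∈ rb (left (Csub x i))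
lastSmaller∈rb-left x {v} {i} {j} ux 1≤i i≤n xi<v eq xj≮xi =
  subst (λ T → j ∈ rb T) (sym left≡cartF)
    (suffixMin∈rb x fuel start (i ∸ start) j length≤fuel start≤j j<end j-min)
  where
  open LeftSubtreeSegment
    (leftSubtreeSegment x (length x) 1 (length x) i ℕₚ.≤-refl 1≤i (s≤s i≤n) (inj₁ refl))
  open IsLastBelow (lastSmaller-just x v (i ∸ 1) eq)

  j<i : j < i
  j<i = ℕₚ.≤-<-trans j≤k (ℕₚ.∸-monoʳ-< {n = 1} ℕₚ.≤-refl 1≤i)

  xi<xj : at x i <ℤ at x j
  xi<xj = ℤₚ.≤∧≢⇒< (ℤₚ.≮⇒≥ xj≮xi) (λ xi≡xj → at-injective x ux 1≤j j<i i≤n (sym xi≡xj))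

  j≮start : start ≡ 1 ⊎ at x (start ∸ 1) ≤ℤ at x i → ¬ j < start
  j≮start (inj₁ start≡1) j<start = ℕₚ.<⇒≱ (subst (j <_) start≡1 j<start) 1≤j
  j≮start (inj₂ xp≤xi) j<start with ℕₚ.m≤n⇒m<n∨m≡n (ℕₚ.pred-mono-≤ j<start)
  ... | inj₁ j<p = last (start ∸ 1) j<p (ℕₚ.∸-monoˡ-≤ 1 start≤h) (ℤₚ.≤-<-trans xp≤xi xi<v)
  ... | inj₂ j≡p = ℤₚ.<⇒≱ xi<xj (subst (λ p → at x p ≤ℤ at x i) (sym j≡p) xp≤xi)

  start≤j : start ≤ j
  start≤j = ℕₚ.≮⇒≥ (j≮start fenced)

  j<end : j < start + (i ∸ start)
  j<end = subst (j <_) (sym (ℕₚ.m+[n∸m]≡n start≤h)) j<i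

  j-min : ∀ q → j < q → q < start + (i ∸ start) → at x j <ℤ at x q
  j-min q j<q q<end = ℤₚ.<-≤-trans below (ℤₚ.≮⇒≥ (last q j<q (ℕₚ.∸-monoˡ-≤ 1 q<i)))
    where
    q<i : q < i
    q<i = subst (q <_) (ℕₚ.m+[n∸m]≡n start≤h) q<end

PD-τ : ∀ x {i} → 1 ≤ i → i < length x →
  PD (τ x i) i ≡ maybe (i ∸_) 0 (lastSmaller x (at x (suc i)) (i ∸ 1))
PD-τ x {i@(suc _)} 1≤i i<n = begin
  PD (τ x i) i
    ≡⟨ PD-lastSmaller (τ x i) i ⟩
  maybe (i ∸_) 0 (lastSmaller (τ x i) (at (τ x i) i) (i ∸ 1))
    ≡⟨ cong (λ v → maybe (i ∸_) 0 (lastSmaller (τ x i) v (i ∸ 1))) (at-τ x 1≤i i<n) ⟩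
  maybe (i ∸_) 0 (lastSmaller (τ x i) (at x (suc i)) (i ∸ 1))
    ≡⟨ cong (maybe (i ∸_) 0) (lastSmaller-cong _ (i ∸ 1) prefix) ⟩
  maybe (i ∸_) 0 (lastSmaller x (at x (suc i)) (i ∸ 1)) ∎
  where
  open ≡-Reasoning
  prefix : ∀ q → 1 ≤ q → q ≤ i ∸ 1 → at (τ x i) q ≡ at x q
  prefix q 1≤q q≤k = at-τ-< x 1≤q (s≤s q≤k)

PD-τ≡PD : ∀ x {i} → 1 ≤ i → i < length x → at x i <ℤ at x (suc i) →
  Maybe.All (λ j → at x j <ℤ at x i) (lastSmaller x (at x (suc i)) (i ∸ 1)) →
  PD (τ x i) i ≡ PD x i
PD-τ≡PD x {i} 1≤i i<n u<v below = begin
  PD (τ x i) i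
    ≡⟨ PD-τ x 1≤i i<n ⟩
  maybe (i ∸_) 0 (lastSmaller x (at x (suc i)) (i ∸ 1))
    ≡⟨ cong (maybe (i ∸_) 0) (lastSmaller-below x (i ∸ 1) u<v below) ⟨
  maybe (i ∸_) 0 (lastSmaller x (at x i) (i ∸ 1))
    ≡⟨ PD-lastSmaller x i ⟨
  PD x i ∎
  where open ≡-Reasoning

lemma4 : (x : List ℤ) → Unique x → (i : ℕ) → 1 ≤ i → suc i ≤ length x →
    at x i <ℤ at x (suc i) →
    (PD (τ x i) i ∈ map (i ∸_) (rb (left (Csub x i)))) ⊎ (PD (τ x i) i ≡ PD x i)
lemma4 x ux i 1≤i i<n u<v with lastSmaller x (at x (suc i)) (i ∸ 1) in eq
... | nothing = inj₂ (PD-τ≡PD x 1≤i i<n u<v (subst (Maybe.All _) (sym eq) Maybe.nothing))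
... | just j with at x j <ℤ? at x i
...   | yes xj<xi = inj₂ (PD-τ≡PD x 1≤i i<n u<v (subst (Maybe.All _) (sym eq) (Maybe.just xj<xi)))
...   | no xj≮xi  = inj₁ (subst (_∈ map (i ∸_) (rb (left (Csub x i)))) (sym PDy≡i-j)
                      (∈-map⁺ (i ∸_) (lastSmaller∈rb-left x ux 1≤i (ℕₚ.<⇒≤ i<n) u<v eq xj≮xi)))
  where
  PDy≡i-j : PD (τ x i) i ≡ i ∸ j
  PDy≡i-j = trans (PD-τ x 1≤i i<n) (cong (maybe (i ∸_) 0) eq)
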